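{- For every simple undirected graph $G$ with vertex set $[n]$, the permutation $\Pi(G)$ belongs to $\tilde{\mathcal{D}}^2_{2n}$.
   Context: $[n]=\{1,\dots,n\}$; $\mathcal{S}_{2n}$ is the symmetric group on $[2n]$, with product meaning composition, $(\sigma\rho)(x)=\sigma(\rho(x))$; $(a,b)$ denotes a transposition. $\tilde{\mathcal{D}}^2_{2n}$ is the set of $\pi\in\mathcal{S}_{2n}$ with $\pi(2i-1)\ge 2i-1$ and $\pi(2i)<2i$ for all $i\in[n]$, and $\pi(2i-1)>2i-1$ for all $i\in[n-1]$. On $\binom{[n]}{2}$ define $\preceq$ by: for $a<b$, $c<d$, $\{a,b\}\preceq\{c,d\}$ iff $c\le a<b\le d$. A valid ordering of $E\subseteq\binom{[n]}{2}$ is a total order $\le$ on $E$ with $e\preceq e'\Rightarrow e\le e'$. For $a<b$ let $\tau(\{a,b\})=(2a,2b-1)$, and $\pi_0=(1,2)(3,4)\cdots(2n-1,2n)$. For a graph $G=([n],E)$ with $E=\{e_1>\dots>e_m\}$ in a valid ordering, $\Pi(G)=\tau(e_m)\tau(e_{m-1})\cdots\tau(e_1)\pi_0$; this is independent of the chosen valid ordering. -}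

module Defs where

open import Data.Nat using (ℕ; zero; suc; _+_; _*_; _∸_; _≤_; _<_; _≡ᵇ_; _≤ᵇ_; _%_)
open import Data.Bool using (if_then_else_; _∧_)
open import Data.Product using (_×_; _,_; proj₁; proj₂)
open import Data.List using (List; []; _∷_)
open import Data.List.Relation.Unary.All using (All)
open import Data.List.Relation.Unary.Unique.Propositional using (Unique)
open import Data.Unit using (⊤)
open import Relation.Binary.PropositionalEquality using (_≡_)
open import Relation.Nullary using (¬_)
open import Function using (_∘_; id)

-- Permutations of [2n] are represented as functions ℕ → ℕ which are
-- the identity outside [2n]; the product σρ is composition σ ∘ ρ.

transp : ℕ → ℕ → ℕ → ℕ
transp a b x = if x ≡ᵇ a then b else (if x ≡ᵇ b then a else x)

π₀ : ℕ → ℕ → ℕ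
π₀ n x = if (1 ≤ᵇ x) ∧ (x ≤ᵇ 2 * n)
         then (if x % 2 ≡ᵇ 0 then x ∸ 1 else suc x)
         else x

-- An element {a,b} of ([n] choose 2) with a < b is stored as the pair (a , b).
Edge : Set
Edge = ℕ × ℕ

IsEdgeOf : ℕ → Edge → Set
IsEdgeOf n (a , b) = (1 ≤ a) × (a < b) × (b ≤ n)

_⪯_ : Edge → Edge → Set
(a , b) ⪯ (c , d) = (c ≤ a) × (a < b) × (b ≤ d)

τ : Edge → ℕ → ℕ
τ (a , b) = transp (2 * a) (2 * b ∸ 1)

-- A list [e₁ , e₂ , … , eₘ] describes the total order e₁ > e₂ > ⋯ > eₘ.
-- It is a valid ordering iff e ⪯ e' ⇒ e ≤ e', i.e. whenever eᵢ comes
-- strictly before eⱼ in the list (so eᵢ > eⱼ), we do not have eᵢ ⪯ eⱼ.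
ValidOrdering : List Edge → Set
ValidOrdering [] = ⊤
ValidOrdering (e ∷ es) = All (λ e' → ¬ (e ⪯ e')) es × ValidOrdering es

prodτ : List Edge → ℕ → ℕ
prodτ [] = id
prodτ (e ∷ es) = prodτ es ∘ τ e

Π : ℕ → List Edge → ℕ → ℕ
Π n es = prodτ es ∘ π₀ n

-- π ∈ 𝒮_{2n}: π restricts to a bijection of [2n] (injective self-map of a finite set)
IsPerm : ℕ → (ℕ → ℕ) → Set
IsPerm n π =
  (∀ x → 1 ≤ x → x ≤ 2 * n → (1 ≤ π x) × (π x ≤ 2 * n)) ×
  (∀ x y → 1 ≤ x → x ≤ 2 * n → 1 ≤ y → y ≤ 2 * n → π x ≡ π y → x ≡ y)

-- π ∈ D̃²_{2n}.  Indices i ∈ [n] are written i = suc j with j < n,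
-- so 2i-1 = 2j+1 and 2i = 2j+2.
InD̃ : ℕ → (ℕ → ℕ) → Set
InD̃ n π =
  IsPerm n π ×
  (∀ j → j < n → (suc (2 * j) ≤ π (suc (2 * j))) × (π (2 + 2 * j) < 2 + 2 * j)) ×
  (∀ j → suc j < n → suc (2 * j) < π (suc (2 * j)))

-- Apply τ(e₁), τ(e₂), … in turn to an even point 2v.  It only moves when it
-- meets an edge {v,b}, which sends it to 2b−1 > 2v.  Validity of the ordering
-- forbids a later edge {x,b} with x ≤ v, so if 2b−1 moves again it goes to some
-- 2x > 2v, and the argument repeats from there.  Hence the product of the τ's
-- never moves an even point down, and symmetrically never moves an odd point up;
-- since π₀ swaps 2i−1 and 2i, Π(G) sends 2i−1 above 2i and 2i below 2i−1.
module Submission where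

open import Defs
open import Data.Nat using (ℕ)
open import Data.List using (List)
open import Data.List.Relation.Unary.All using (All)
open import Data.List.Relation.Unary.Unique.Propositional using (Unique)

open import Data.Bool using (T; true; false; if_then_else_)
open import Data.Bool.Properties using (T-≡)
open import Data.List using ([]; _∷_)
open import Data.List.Relation.Unary.All using ([]; _∷_; map)
open import Data.Nat using (zero; suc; _+_; _*_; _∸_; _≤_; _<_; _≡ᵇ_; _%_; z≤n; s≤s; s≤s⁻¹; _≟_)
open import Data.Nat.DivMod using ([m+kn]%n≡m%n)
open import Data.Nat.Properties
open import Data.Product using (_×_; _,_; proj₁; proj₂; ∃-syntax)
open import Data.Sum using (_⊎_; inj₁; inj₂)
open import Function using (_∘_)
open import Function.Bundles using (Equivalence)
open import Relation.Binary.PropositionalEquality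
open import Relation.Nullary using (¬_; yes; no; contradiction)

≡ᵇ-refl : ∀ x → (x ≡ᵇ x) ≡ true
≡ᵇ-refl x = Equivalence.to T-≡ (≡⇒≡ᵇ x x refl)

≢⇒≡ᵇ-false : ∀ {x a} → x ≢ a → (x ≡ᵇ a) ≡ false
≢⇒≡ᵇ-false {x} {a} x≢a with x ≡ᵇ a in eq
... | true  = contradiction (≡ᵇ⇒≡ x a (subst T (sym eq) _)) x≢a
... | false = refl

transp-left : ∀ a b → transp a b a ≡ b
transp-left a b rewrite ≡ᵇ-refl a = refl

transp-right : ∀ a b → transp a b b ≡ a
transp-right a b with b ≟ a
... | yes refl rewrite ≡ᵇ-refl a = refl
... | no b≢a rewrite ≢⇒≡ᵇ-false b≢a | ≡ᵇ-refl b = refl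

transp-other : ∀ {a b x} → x ≢ a → x ≢ b → transp a b x ≡ x
transp-other x≢a x≢b rewrite ≢⇒≡ᵇ-false x≢a | ≢⇒≡ᵇ-false x≢b = refl

transp-preserves : ∀ (P : ℕ → Set) {a b} x → P a → P b → P x → P (transp a b x)
transp-preserves P {a} {b} x pa pb px with x ≟ a
... | yes refl rewrite transp-left x b = pb
... | no x≢a with x ≟ b
...   | yes refl rewrite transp-right a x = pa
...   | no x≢b rewrite transp-other x≢a x≢b = px

transp-involutive : ∀ a b x → transp a b (transp a b x) ≡ x
transp-involutive a b x with x ≟ a
... | yes refl rewrite transp-left x b = transp-right x b
... | no x≢a with x ≟ b
...   | yes refl rewrite transp-right a x = transp-left a x
...   | no x≢b rewrite transp-other {a} {b} x≢a x≢b = transp-other x≢a x≢b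

transp-injective : ∀ a b {x y} → transp a b x ≡ transp a b y → x ≡ y
transp-injective a b {x} {y} eq = begin
  x                           ≡⟨ sym (transp-involutive a b x) ⟩
  transp a b (transp a b x)   ≡⟨ cong (transp a b) eq ⟩
  transp a b (transp a b y)   ≡⟨ transp-involutive a b y ⟩
  y                           ∎
  where open ≡-Reasoning

-- Edges are matched as (a , suc b), so that the odd point 2(b+1)−1 moved by τ
-- becomes suc (2 * b), free of truncated subtraction.
τ-odd : ∀ a b x → τ (a , suc b) x ≡ transp (2 * a) (suc (2 * b)) x
τ-odd a b x = cong (λ c → transp (2 * a) c x) (cong (_∸ 1) (*-suc 2 b))

τ-start : ∀ a b → τ (a , suc b) (2 * a) ≡ suc (2 * b)
τ-start a b = trans (τ-odd a b (2 * a)) (transp-left (2 * a) (suc (2 * b)))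

τ-end : ∀ a b → τ (a , suc b) (suc (2 * b)) ≡ 2 * a
τ-end a b = trans (τ-odd a b (suc (2 * b))) (transp-right (2 * a) (suc (2 * b)))

τ-other-even : ∀ {a v} b → v ≢ a → τ (a , suc b) (2 * v) ≡ 2 * v
τ-other-even {a} {v} b v≢a =
  trans (τ-odd a b (2 * v)) (transp-other (v≢a ∘ *-cancelˡ-≡ v a 2) (even≢odd v b))

τ-other-odd : ∀ a {b c} → c ≢ b → τ (a , suc b) (suc (2 * c)) ≡ suc (2 * c)
τ-other-odd a {b} {c} c≢b =
  trans (τ-odd a b (suc (2 * c)))
    (transp-other (even≢odd a c ∘ sym) (c≢b ∘ *-cancelˡ-≡ c b 2 ∘ suc-injective))

Ordered : Edge → Set
Ordered (a , b) = a < b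

NotNestedIn : Edge → List Edge → Set
NotNestedIn e = All (λ e′ → ¬ (e ⪯ e′))

starts-right-of : ∀ {a b x} → a < b → ¬ ((a , b) ⪯ (x , b)) → a < x
starts-right-of a<b ¬⪯ = ≰⇒> (λ x≤a → ¬⪯ (x≤a , a<b , ≤-refl))

ends-left-of : ∀ {a b y} → a < b → ¬ ((a , b) ⪯ (a , y)) → y < b
ends-left-of a<b ¬⪯ = ≰⇒> (λ b≤y → ¬⪯ (≤-refl , a<b , b≤y))

mutual
  prodτ-even-≥ : ∀ {es} → All Ordered es → ValidOrdering es →
                 ∀ v → 2 * v ≤ prodτ es (2 * v)
  prodτ-even-≥ [] _ v = ≤-refl
  prodτ-even-≥ {(a , suc b) ∷ es} (a<b ∷ os) (nn , vo) v with v ≟ a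
  ... | yes refl rewrite τ-start v b = <⇒≤ (prodτ-odd-> os vo a<b nn)
  ... | no v≢a rewrite τ-other-even b v≢a = prodτ-even-≥ os vo v

  prodτ-odd-> : ∀ {es a b} → All Ordered es → ValidOrdering es →
                a < suc b → NotNestedIn (a , suc b) es →
                2 * a < prodτ es (suc (2 * b))
  prodτ-odd-> [] _ a<b [] = s≤s (*-monoʳ-≤ 2 (s≤s⁻¹ a<b))
  prodτ-odd-> {(x , suc y) ∷ es} {b = b} (_ ∷ os) (_ , vo) a<b (¬⪯ ∷ nns) with b ≟ y
  ... | yes refl rewrite τ-end x b =
        <-≤-trans (*-monoʳ-< 2 (starts-right-of a<b ¬⪯)) (prodτ-even-≥ os vo x)
  ... | no b≢y rewrite τ-other-odd x b≢y = prodτ-odd-> os vo a<b nns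

mutual
  prodτ-odd-≤ : ∀ {es} → All Ordered es → ValidOrdering es →
                ∀ b → prodτ es (suc (2 * b)) ≤ suc (2 * b)
  prodτ-odd-≤ [] _ b = ≤-refl
  prodτ-odd-≤ {(a , suc b′) ∷ es} (a<b′ ∷ os) (nn , vo) b with b ≟ b′
  ... | yes refl rewrite τ-end a b = m≤n⇒m≤1+n (prodτ-even-≤ os vo a<b′ nn)
  ... | no b≢b′ rewrite τ-other-odd a b≢b′ = prodτ-odd-≤ os vo b

  prodτ-even-≤ : ∀ {es a b} → All Ordered es → ValidOrdering es →
                 a < suc b → NotNestedIn (a , suc b) es →
                 prodτ es (2 * a) ≤ 2 * b
  prodτ-even-≤ [] _ a<b [] = *-monoʳ-≤ 2 (s≤s⁻¹ a<b)
  prodτ-even-≤ {(x , suc y) ∷ es} {a} (_ ∷ os) (_ , vo) a<b (¬⪯ ∷ nns) with a ≟ x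
  ... | yes refl rewrite τ-start a y =
        ≤-trans (prodτ-odd-≤ os vo y) (*-monoʳ-< 2 (s≤s⁻¹ (ends-left-of a<b ¬⪯)))
  ... | no a≢x rewrite τ-other-even y a≢x = prodτ-even-≤ os vo a<b nns

prodτ-injective : ∀ es {x y} → prodτ es x ≡ prodτ es y → x ≡ y
prodτ-injective []            eq = eq
prodτ-injective ((a , b) ∷ es) eq =
  transp-injective (2 * a) (2 * b ∸ 1) (prodτ-injective es eq)

InRange : ℕ → ℕ → Set
InRange n x = (1 ≤ x) × (x ≤ 2 * n)

τ-preserves-range : ∀ {n e} → IsEdgeOf n e → ∀ x → InRange n x → InRange n (τ e x)
τ-preserves-range {n} {a , suc b} (1≤a , a<b , b<n) x x∈ =
  subst (InRange n) (sym (τ-odd a b x))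
    (transp-preserves (InRange n) x
      (≤-trans 1≤a (m≤m+n a _) , *-monoʳ-≤ 2 (<⇒≤ (<-≤-trans a<b b<n)))
      (s≤s z≤n , *-monoʳ-< 2 b<n)
      x∈)

prodτ-preserves-range : ∀ {n es} → All (IsEdgeOf n) es →
                        ∀ x → InRange n x → InRange n (prodτ es x)
prodτ-preserves-range []       x x∈ = x∈
prodτ-preserves-range (e ∷ es) x x∈ =
  prodτ-preserves-range es _ (τ-preserves-range e x x∈)

data Position (n : ℕ) : ℕ → Set where
  odd  : ∀ {k} → k < n → Position n (suc (2 * k))
  even : ∀ {k} → k < n → Position n (2 + 2 * k)

halve : ∀ m → ∃[ k ] (m ≡ 2 * k ⊎ m ≡ suc (2 * k))
halve zero = 0 , inj₁ refl
halve (suc m) with halve m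
... | k , inj₁ refl = k , inj₂ refl
... | k , inj₂ refl = suc k , inj₁ (sym (*-suc 2 k))

position : ∀ n {x} → InRange n x → Position n x
position n {suc m} (_ , x≤2n) with halve m
... | k , inj₁ refl = odd (*-cancelˡ-< 2 k n x≤2n)
... | k , inj₂ refl = even (*-cancelˡ-< 2 k n (≤-trans (n≤1+n _) x≤2n))

odd-in-range : ∀ {n k} → k < n → InRange n (suc (2 * k))
odd-in-range k<n = s≤s z≤n , *-monoʳ-< 2 k<n

even-in-range : ∀ {n k} → k < n → InRange n (2 + 2 * k)
even-in-range {n} {k} k<n = s≤s z≤n , subst (_≤ 2 * n) (*-suc 2 k) (*-monoʳ-≤ 2 k<n)

π₀-on-range : ∀ n {x} → InRange n x → π₀ n x ≡ (if x % 2 ≡ᵇ 0 then x ∸ 1 else suc x)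
π₀-on-range _ (1≤x , x≤2n)
  rewrite Equivalence.to T-≡ (≤⇒≤ᵇ 1≤x) | Equivalence.to T-≡ (≤⇒≤ᵇ x≤2n) = refl

[m+2k]%2≡m%2 : ∀ m k → (m + 2 * k) % 2 ≡ m % 2
[m+2k]%2≡m%2 m k = trans (cong (λ j → (m + j) % 2) (*-comm 2 k)) ([m+kn]%n≡m%n m k 2)

π₀-odd : ∀ {n k} → k < n → π₀ n (suc (2 * k)) ≡ 2 + 2 * k
π₀-odd {n} {k} k<n =
  trans (π₀-on-range n (odd-in-range k<n))
        (cong (λ r → if r ≡ᵇ 0 then 2 * k else 2 + 2 * k) ([m+2k]%2≡m%2 1 k))

π₀-even : ∀ {n k} → k < n → π₀ n (2 + 2 * k) ≡ suc (2 * k)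
π₀-even {n} {k} k<n =
  trans (π₀-on-range n (even-in-range k<n))
        (cong (λ r → if r ≡ᵇ 0 then suc (2 * k) else 3 + 2 * k) ([m+2k]%2≡m%2 2 k))

π₀-preserves-range : ∀ n x → InRange n x → InRange n (π₀ n x)
π₀-preserves-range n x x∈ with position n x∈
... | odd k<n  = subst (InRange n) (sym (π₀-odd k<n)) (even-in-range k<n)
... | even k<n = subst (InRange n) (sym (π₀-even k<n)) (odd-in-range k<n)

π₀-involutive : ∀ n {x} → InRange n x → π₀ n (π₀ n x) ≡ x
π₀-involutive n x∈ with position n x∈
... | odd k<n  = trans (cong (π₀ n) (π₀-odd k<n)) (π₀-even k<n)
... | even k<n = trans (cong (π₀ n) (π₀-even k<n)) (π₀-odd k<n)

π₀-injective : ∀ n {x y} → InRange n x → InRange n y → π₀ n x ≡ π₀ n y → x ≡ y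
π₀-injective n {x} {y} x∈ y∈ eq = begin
  x               ≡⟨ sym (π₀-involutive n x∈) ⟩
  π₀ n (π₀ n x)   ≡⟨ cong (π₀ n) eq ⟩
  π₀ n (π₀ n y)   ≡⟨ π₀-involutive n y∈ ⟩
  y               ∎
  where open ≡-Reasoning

mainTheorem3 : (n : ℕ) (E : List Edge) →
    All (IsEdgeOf n) E → Unique E → ValidOrdering E →
    InD̃ n (Π n E)
mainTheorem3 n E edges _ valid =  -- the edges need not be distinct
  ( (λ x 1≤x x≤2n → prodτ-preserves-range edges _ (π₀-preserves-range n x (1≤x , x≤2n)))
  , (λ x y 1≤x x≤2n 1≤y y≤2n eq →
       π₀-injective n (1≤x , x≤2n) (1≤y , y≤2n) (prodτ-injective E eq)) )
  , (λ j j<n → <⇒≤ (odd-moves-up j<n) , even-moves-down j<n)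
  , (λ j 1+j<n → odd-moves-up (<-trans (n<1+n j) 1+j<n))
  where
  open ≤-Reasoning
  ordered : All Ordered E
  ordered = map (proj₁ ∘ proj₂) edges

  odd-moves-up : ∀ {j} → j < n → suc (2 * j) < Π n E (suc (2 * j))
  odd-moves-up {j} j<n = begin-strict
    suc (2 * j)           <⟨ n<1+n _ ⟩
    2 + 2 * j             ≡⟨ *-suc 2 j ⟨
    2 * suc j             ≤⟨ prodτ-even-≥ ordered valid (suc j) ⟩
    prodτ E (2 * suc j)   ≡⟨ cong (prodτ E) (trans (*-suc 2 j) (sym (π₀-odd j<n))) ⟩
    Π n E (suc (2 * j))   ∎

  even-moves-down : ∀ {j} → j < n → Π n E (2 + 2 * j) < 2 + 2 * j
  even-moves-down {j} j<n = begin-strict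
    Π n E (2 + 2 * j)     ≡⟨ cong (prodτ E) (π₀-even j<n) ⟩
    prodτ E (suc (2 * j)) ≤⟨ prodτ-odd-≤ ordered valid j ⟩
    suc (2 * j)           <⟨ n<1+n _ ⟩
    2 + 2 * j             ∎
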